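{- For $100\%$ of the elliptic curves $E\in\mathcal{E}_2$ (ordered by height $H$), $E(\mathbb{Q})[2]\cong\mathbb{Z}/2\mathbb{Z}$; i.e. $\#\{E\in\mathcal{E}_2: H(E)\le X, E(\mathbb{Q})[2]\not\cong\mathbb{Z}/2\mathbb{Z}\}=o(\#\{E\in\mathcal{E}_2: H(E)\le X\})$.
   Context: Minimal models $E_{A,B}: y^2=x^3+Ax+B$ ($A,B\in\mathbb{Z}$, no prime $p$ with $p^4\mid A$, $p^6\mid B$) have height $H(E_{A,B})=\max\{|A|^3,|B|^2\}^{1/6}$; $\mathcal{E}_2$ is the set of such curves with a nontrivial rational point of order $2$. -}

module Defs where

open import Data.Nat as ℕ using (ℕ; suc; _^_; _≤_)
open import Data.Nat.Divisibility using (_∣_)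
open import Data.Nat.Primality using (Prime)
open import Data.Integer as ℤ using (ℤ; +_)
open import Data.Rational as ℚ using (ℚ; 0ℚ)
open import Data.Product using (_×_; ∃; Σ; _,_)
open import Relation.Nullary using (¬_)
open import Relation.Binary.PropositionalEquality using (_≡_; _≢_)

-- A Weierstrass model y^2 = x^3 + A x + B is encoded by the pair (A , B).
Model : Set
Model = ℤ × ℤ

-- Nonsingular: discriminant -16(4A^3+27B^2) ≠ 0.
Nonsingular : Model → Set
Nonsingular (A , B) = (+ 4 ℤ.* (A ℤ.* A ℤ.* A)) ℤ.+ (+ 27 ℤ.* (B ℤ.* B)) ≢ + 0

Minimal : Model → Set
Minimal (A , B) = ∀ p → Prime p → ¬ ((p ^ 4 ∣ ℤ.∣ A ∣) × (p ^ 6 ∣ ℤ.∣ B ∣))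

-- A rational x-coordinate of a point of order 2: a rational root of x^3 + A x + B.
IsTwoTorsionX : Model → ℚ → Set
IsTwoTorsionX (A , B) q = (q ℚ.* q ℚ.* q) ℚ.+ ((A ℚ./ 1) ℚ.* q) ℚ.+ (B ℚ./ 1) ≡ 0ℚ

InE₂ : Model → Set
InE₂ E = Minimal E × Nonsingular E × ∃ (λ q → IsTwoTorsionX E q)

-- E(Q)[2] has all three nontrivial points rational (E(Q)[2] ≅ (Z/2)^2),
-- i.e. three pairwise distinct rational roots of x^3 + A x + B.
FullTwoTorsion : Model → Set
FullTwoTorsion E = Σ ℚ λ q₁ → Σ ℚ λ q₂ → Σ ℚ λ q₃ →
  IsTwoTorsionX E q₁ × IsTwoTorsionX E q₂ × IsTwoTorsionX E q₃ ×
  q₁ ≢ q₂ × q₁ ≢ q₃ × q₂ ≢ q₃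

-- H(E)^6 = max(|A|^3, B^2) ≤ T   (T plays the role of X^6).
HeightPow6≤ : ℕ → Model → Set
HeightPow6≤ T (A , B) = (ℤ.∣ A ∣ ^ 3 ≤ T) × (ℤ.∣ B ∣ ^ 2 ≤ T)

module Submission where

-- If E has full rational 2-torsion, the roots of x³ + A x + B are rational, hence integral (the
-- cubic is monic), say x, y and -(x+y); then (A , B) = (-(x²+xy+y²), xy(x+y)).  Choose m with
-- 64 m⁶ ≤ T < 64 (m+1)⁶.  Since 4(x²+xy+y²) ≥ 3x², the bound |A|³ ≤ T forces |x|, |y| ≤ 3m+2,
-- so there are at most (6m+5)² such curves.  On the other hand, for r = 2^j with j < R and odd
-- A = 2a+1 ≤ 4m², the model (A , -(r³+Ar)) has the rational 2-torsion point (r , 0), is minimal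
-- because a prime dividing A and r³+Ar would divide r, is nonsingular because A > 0, and has
-- height⁶ ≤ 64 m⁶.  These R · 2m² curves are pairwise distinct, and once 2^R ≤ m (which holds for
-- T large) they outnumber (k+1)(6m+5)² for R = 61(k+1).

open import Defs
open import Data.Nat using (ℕ; suc; _*_; _≤_)
open import Data.List using (List; length)
open import Data.List.Relation.Unary.All using (All)
open import Data.List.Relation.Unary.Unique.Propositional using (Unique)
open import Data.Product using (_×_; ∃)

open import Data.Nat using (zero; _+_; _^_; _<_; _≤?_; _<?_; z≤n; s≤s; nonTrivial⇒≢1)
import Data.Nat.Properties as ℕP
import Data.Nat.Solver as ℕSolver
open import Data.Nat.Divisibility using (_∣_; ∣1⇒≡1; m∣m*n; ∣-trans; ∣m⇒∣m*n; ∣m+n∣m⇒∣n; module ∣-Reasoning)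
open import Data.Nat.Coprimality as Coprimality using (Coprime; coprime-divisor)
open import Data.Nat.Primality using (Prime; euclidsLemma; prime⇒nonTrivial)
open import Data.Integer as ℤ using (ℤ; +_; -[1+_]; +[1+_]; 0ℤ; 1ℤ)
import Data.Integer.Properties as ℤP
import Data.Integer.Solver as ℤSolver
open import Data.Rational as ℚ using (ℚ; mkℚ; 0ℚ; 1ℚ; ↥_; ↧_; toℚᵘ)
import Data.Rational.Properties as ℚP
import Data.Rational.Solver as ℚSolver
open import Data.Rational.Unnormalised as ℚᵘ using (mkℚᵘ; *≡*) renaming (_≃_ to _≃ᵘ_)
import Data.Rational.Unnormalised.Properties as ℚᵘP
open import Data.Product using (_,_; proj₁; proj₂)
open import Data.Sum using (inj₁; inj₂; [_,_]′)
open import Data.Empty using (⊥)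
open import Data.List using ([]; _∷_; _++_; map; upTo; cartesianProductWith)
import Data.List.Properties as ListP
open import Data.List.Membership.Propositional using (_∈_)
open import Data.List.Membership.Propositional.Properties
  using (∈-cartesianProductWith⁺; ∈-cartesianProductWith⁻; ∈-∃++; ∈-++⁻; ∈-++⁺ˡ; ∈-++⁺ʳ; ∈-map⁺; ∈-upTo⁺; ∈-upTo⁻)
open import Data.List.Relation.Binary.Subset.Propositional using (_⊆_)
open import Data.List.Relation.Unary.Any using (here; there)
import Data.List.Relation.Unary.All as All
open import Data.List.Relation.Unary.AllPairs using (_∷_)
open import Data.List.Relation.Unary.Unique.Propositional.Properties using (cartesianProductWith⁺; upTo⁺)
open import Function using (id)
open import Relation.Binary.Definitions using (Monotonic₁)
open import Relation.Nullary using (yes; no)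
open import Relation.Nullary.Negation using (contradiction)
open import Relation.Binary.PropositionalEquality

coprime∧∣^⇒≡1 : ∀ {d n} k → Coprime d n → d ∣ n ^ k → d ≡ 1
coprime∧∣^⇒≡1 zero    _   d∣1   = ∣1⇒≡1 d∣1
coprime∧∣^⇒≡1 (suc k) d⊥n d∣nᵏ⁺¹ = coprime∧∣^⇒≡1 k d⊥n (coprime-divisor d⊥n d∣nᵏ⁺¹)

prime∣^⇒∣ : ∀ {p m} n → Prime p → p ∣ m ^ n → p ∣ m
prime∣^⇒∣ zero    p-prime p∣1 = contradiction (∣1⇒≡1 p∣1) (nonTrivial⇒≢1 {{prime⇒nonTrivial p-prime}})
prime∣^⇒∣ {m = m} (suc n) p-prime p∣mᵐ⁺¹ with euclidsLemma m (m ^ n) p-prime p∣mᵐ⁺¹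
... | inj₁ p∣m  = p∣m
... | inj₂ p∣mⁿ = prime∣^⇒∣ n p-prime p∣mⁿ

module StrictlyIncreasing {f : ℕ → ℕ} (f-mono : Monotonic₁ _<_ _<_ f) where

  injective : ∀ {m n} → f m ≡ f n → m ≡ n
  injective fm≡fn = ℕP.≤-antisym (ℕP.≮⇒≥ (λ n<m → ℕP.<-irrefl (sym fm≡fn) (f-mono n<m)))
                                 (ℕP.≮⇒≥ (λ m<n → ℕP.<-irrefl fm≡fn (f-mono m<n)))

  mono-≤ : Monotonic₁ _≤_ _≤_ f
  mono-≤ m≤n with ℕP.m≤n⇒m<n∨m≡n m≤n
  ... | inj₁ m<n  = ℕP.<⇒≤ (f-mono m<n)
  ... | inj₂ refl = ℕP.≤-refl

  floor : f 0 ≡ 0 → ∀ T → ∃ λ m → f m ≤ T × T < f (suc m)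
  floor f0≡0 zero = 0 , ℕP.≤-reflexive f0≡0 , subst (_< f 1) f0≡0 (f-mono (ℕP.n<1+n 0))
  floor f0≡0 (suc T) with floor f0≡0 T
  ... | m , fm≤T , T<f[m+1] with suc T <? f (suc m)
  ...   | yes T+1<f[m+1] = m , ℕP.m≤n⇒m≤1+n fm≤T , T+1<f[m+1]
  ...   | no  T+1≮f[m+1] = suc m , ℕP.≤-reflexive (sym T+1≡f[m+1]) ,
                           subst (_< f (suc (suc m))) (sym T+1≡f[m+1]) (f-mono (ℕP.n<1+n (suc m)))
    where
    T+1≡f[m+1] : suc T ≡ f (suc m)
    T+1≡f[m+1] = ℕP.≤-antisym T<f[m+1] (ℕP.≮⇒≥ T+1≮f[m+1])

  floor-maximal : ∀ {c m T} → f c ≤ T → T < f (suc m) → c ≤ m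
  floor-maximal {c} {m} fc≤T T<f[m+1] =
    ℕP.≮⇒≥ (λ m<c → ℕP.<⇒≱ T<f[m+1] (ℕP.≤-trans (mono-≤ m<c) fc≤T))

Unique∧⊆⇒length≤ : ∀ {A : Set} {xs ys : List A} → Unique xs → xs ⊆ ys → length xs ≤ length ys
Unique∧⊆⇒length≤ {xs = []}     _              _    = z≤n
Unique∧⊆⇒length≤ {xs = x ∷ xs} (x∉xs ∷ xs!) x∷xs⊆ys with ∈-∃++ (x∷xs⊆ys (here refl))
... | as , bs , refl =
  ℕP.≤-trans (s≤s (Unique∧⊆⇒length≤ xs! xs⊆as++bs)) (ℕP.≤-reflexive (sym (ListP.length-++-sucʳ as x bs)))
  where
  xs⊆as++bs : xs ⊆ as ++ bs
  xs⊆as++bs y∈xs with ∈-++⁻ as (x∷xs⊆ys (there y∈xs))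
  ... | inj₁ y∈as        = ∈-++⁺ˡ y∈as
  ... | inj₂ (here y≡x)  = contradiction (sym y≡x) (All.lookup x∉xs y∈xs)
  ... | inj₂ (there y∈bs) = ∈-++⁺ʳ as y∈bs

length-cartesianProductWith : ∀ {A B C : Set} (f : A → B → C) xs ys →
  length (cartesianProductWith f xs ys) ≡ length xs * length ys
length-cartesianProductWith f []       ys = refl
length-cartesianProductWith f (x ∷ xs) ys = begin
  length (map (f x) ys ++ cartesianProductWith f xs ys)
    ≡⟨ ListP.length-++ (map (f x) ys) ⟩
  length (map (f x) ys) + length (cartesianProductWith f xs ys)
    ≡⟨ cong₂ _+_ (ListP.length-map (f x) ys) (length-cartesianProductWith f xs ys) ⟩
  length ys + length xs * length ys ∎
  where open ≡-Reasoning

integersUpTo : ℕ → List ℤ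
integersUpTo c = map +_ (upTo (suc c)) ++ map -[1+_] (upTo c)

∈-integersUpTo : ∀ {c} i → ℤ.∣ i ∣ ≤ c → i ∈ integersUpTo c
∈-integersUpTo     (+ n)    n≤c   = ∈-++⁺ˡ (∈-map⁺ +_ (∈-upTo⁺ (s≤s n≤c)))
∈-integersUpTo {c} -[1+ n ] n+1≤c = ∈-++⁺ʳ (map +_ (upTo (suc c))) (∈-map⁺ -[1+_] (∈-upTo⁺ n+1≤c))

length-integersUpTo : ∀ c → length (integersUpTo c) ≡ suc c + c
length-integersUpTo c = begin
  length (map +_ (upTo (suc c)) ++ map -[1+_] (upTo c))
    ≡⟨ ListP.length-++ (map +_ (upTo (suc c))) ⟩
  length (map +_ (upTo (suc c))) + length (map -[1+_] (upTo c))
    ≡⟨ cong₂ _+_ (ListP.length-map +_ (upTo (suc c))) (ListP.length-map -[1+_] (upTo c)) ⟩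
  length (upTo (suc c)) + length (upTo c)
    ≡⟨ cong₂ _+_ (ListP.length-upTo (suc c)) (ListP.length-upTo c) ⟩
  suc c + c ∎
  where open ≡-Reasoning

fromℤ : ℤ → ℚ
fromℤ i = i ℚ./ 1

toℚᵘ-fromℤ : ∀ i → toℚᵘ (fromℤ i) ≃ᵘ mkℚᵘ i 0
toℚᵘ-fromℤ i = ℚP.toℚᵘ-fromℚᵘ (mkℚᵘ i 0)

fromℤ-homo-+ : ∀ i j → fromℤ (i ℤ.+ j) ≡ fromℤ i ℚ.+ fromℤ j
fromℤ-homo-+ i j = ℚP.toℚᵘ-injective (begin
  toℚᵘ (fromℤ (i ℤ.+ j))              ≈⟨ toℚᵘ-fromℤ (i ℤ.+ j) ⟩
  mkℚᵘ (i ℤ.+ j) 0                    ≈⟨ *≡* (solve 2 (λ i j → (i :+ j) :* con 1ℤ := (i :* con 1ℤ :+ j :* con 1ℤ) :* con 1ℤ) refl i j) ⟩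
  mkℚᵘ i 0 ℚᵘ.+ mkℚᵘ j 0              ≈⟨ ℚᵘP.+-cong (toℚᵘ-fromℤ i) (toℚᵘ-fromℤ j) ⟨
  toℚᵘ (fromℤ i) ℚᵘ.+ toℚᵘ (fromℤ j)  ≈⟨ ℚP.toℚᵘ-homo-+ (fromℤ i) (fromℤ j) ⟨
  toℚᵘ (fromℤ i ℚ.+ fromℤ j)          ∎)
  where open ℚᵘP.≃-Reasoning; open ℤSolver.+-*-Solver

fromℤ-homo-* : ∀ i j → fromℤ (i ℤ.* j) ≡ fromℤ i ℚ.* fromℤ j
fromℤ-homo-* i j = ℚP.toℚᵘ-injective (begin
  toℚᵘ (fromℤ (i ℤ.* j))              ≈⟨ toℚᵘ-fromℤ (i ℤ.* j) ⟩
  mkℚᵘ (i ℤ.* j) 0                    ≈⟨ ℚᵘP.*-cong (toℚᵘ-fromℤ i) (toℚᵘ-fromℤ j) ⟨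
  toℚᵘ (fromℤ i) ℚᵘ.* toℚᵘ (fromℤ j)  ≈⟨ ℚP.toℚᵘ-homo-* (fromℤ i) (fromℤ j) ⟨
  toℚᵘ (fromℤ i ℚ.* fromℤ j)          ∎)
  where open ℚᵘP.≃-Reasoning

fromℤ-injective : ∀ {i j} → fromℤ i ≡ fromℤ j → i ≡ j
fromℤ-injective {i} {j} eq
  with ℚᵘP.≃-trans (ℚᵘP.≃-sym (toℚᵘ-fromℤ i)) (ℚᵘP.≃-trans (ℚP.toℚᵘ-cong eq) (toℚᵘ-fromℤ j))
... | *≡* i*1≡j*1 = trans (sym (ℤP.*-identityʳ i)) (trans i*1≡j*1 (ℤP.*-identityʳ j))

*-fromℤ-denominator : ∀ q → q ℚ.* fromℤ (↧ q) ≡ fromℤ (↥ q)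
*-fromℤ-denominator q@(mkℚ n d-1 _) = ℚP.toℚᵘ-injective (begin
  toℚᵘ (q ℚ.* fromℤ (↧ q))            ≈⟨ ℚP.toℚᵘ-homo-* q (fromℤ (↧ q)) ⟩
  toℚᵘ q ℚᵘ.* toℚᵘ (fromℤ (↧ q))      ≈⟨ ℚᵘP.*-congˡ {toℚᵘ q} (toℚᵘ-fromℤ (↧ q)) ⟩
  mkℚᵘ n d-1 ℚᵘ.* mkℚᵘ (↧ q) 0         ≈⟨ *≡* (trans (ℤP.*-identityʳ _) (cong (λ z → n ℤ.* + z) (sym (ℕP.*-identityʳ (suc d-1))))) ⟩
  mkℚᵘ n 0                            ≈⟨ toℚᵘ-fromℤ n ⟨
  toℚᵘ (fromℤ n)                      ∎)
  where open ℚᵘP.≃-Reasoning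

cubic : Model → ℤ → ℤ
cubic (A , B) x = x ℤ.* x ℤ.* x ℤ.+ A ℤ.* x ℤ.+ B

cubicForm : Model → ℤ → ℤ → ℤ
cubicForm (A , B) n d = n ℤ.* n ℤ.* n ℤ.+ A ℤ.* n ℤ.* (d ℤ.* d) ℤ.+ B ℤ.* (d ℤ.* d ℤ.* d)

cubicForm-dehomogenise : ∀ E x → cubicForm E x 1ℤ ≡ cubic E x
cubicForm-dehomogenise (A , B) x = solve 3 (λ x A B →
  x :* x :* x :+ A :* x :* (con 1ℤ :* con 1ℤ) :+ B :* (con 1ℤ :* con 1ℤ :* con 1ℤ) := x :* x :* x :+ A :* x :+ B) refl x A B
  where open ℤSolver.+-*-Solver

fromℤ-cubicForm : ∀ A B n d → fromℤ (cubicForm (A , B) n d) ≡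
  fromℤ n ℚ.* fromℤ n ℚ.* fromℤ n ℚ.+ fromℤ A ℚ.* fromℤ n ℚ.* (fromℤ d ℚ.* fromℤ d)
    ℚ.+ fromℤ B ℚ.* (fromℤ d ℚ.* fromℤ d ℚ.* fromℤ d)
fromℤ-cubicForm A B n d = begin
  fromℤ (n³ ℤ.+ A ℤ.* n ℤ.* d² ℤ.+ B ℤ.* d³)
    ≡⟨ fromℤ-homo-+ (n³ ℤ.+ A ℤ.* n ℤ.* d²) (B ℤ.* d³) ⟩
  fromℤ (n³ ℤ.+ A ℤ.* n ℤ.* d²) ℚ.+ fromℤ (B ℤ.* d³)
    ≡⟨ cong₂ ℚ._+_ (fromℤ-homo-+ n³ (A ℤ.* n ℤ.* d²)) (fromℤ-homo-* B d³) ⟩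
  fromℤ n³ ℚ.+ fromℤ (A ℤ.* n ℤ.* d²) ℚ.+ fromℤ B ℚ.* fromℤ d³
    ≡⟨ cong₂ ℚ._+_ (cong₂ ℚ._+_ (fromℤ-homo-*³ n n n) A*n*d²) (cong (fromℤ B ℚ.*_) (fromℤ-homo-*³ d d d)) ⟩
  fromℤ n ℚ.* fromℤ n ℚ.* fromℤ n ℚ.+ fromℤ A ℚ.* fromℤ n ℚ.* (fromℤ d ℚ.* fromℤ d)
    ℚ.+ fromℤ B ℚ.* (fromℤ d ℚ.* fromℤ d ℚ.* fromℤ d) ∎
  where
  open ≡-Reasoning
  n³ = n ℤ.* n ℤ.* n
  d² = d ℤ.* d
  d³ = d ℤ.* d ℤ.* d
  fromℤ-homo-*³ : ∀ x y z → fromℤ (x ℤ.* y ℤ.* z) ≡ fromℤ x ℚ.* fromℤ y ℚ.* fromℤ z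
  fromℤ-homo-*³ x y z = trans (fromℤ-homo-* (x ℤ.* y) z) (cong (ℚ._* fromℤ z) (fromℤ-homo-* x y))
  A*n*d² : fromℤ (A ℤ.* n ℤ.* d²) ≡ fromℤ A ℚ.* fromℤ n ℚ.* (fromℤ d ℚ.* fromℤ d)
  A*n*d² = trans (fromℤ-homo-* (A ℤ.* n) d²) (cong₂ ℚ._*_ (fromℤ-homo-* A n) (fromℤ-homo-* d d))

cubic≡0⇒IsTwoTorsionX : ∀ E x → cubic E x ≡ 0ℤ → IsTwoTorsionX E (fromℤ x)
cubic≡0⇒IsTwoTorsionX E@(A , B) x root = begin
  X ℚ.* X ℚ.* X ℚ.+ fromℤ A ℚ.* X ℚ.+ fromℤ B
    ≡⟨ solve 3 (λ X A B → X :* X :* X :+ A :* X :+ B :=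
         X :* X :* X :+ A :* X :* (con 1ℚ :* con 1ℚ) :+ B :* (con 1ℚ :* con 1ℚ :* con 1ℚ)) refl X (fromℤ A) (fromℤ B) ⟩
  X ℚ.* X ℚ.* X ℚ.+ fromℤ A ℚ.* X ℚ.* (1ℚ ℚ.* 1ℚ) ℚ.+ fromℤ B ℚ.* (1ℚ ℚ.* 1ℚ ℚ.* 1ℚ)
    ≡⟨ fromℤ-cubicForm A B x 1ℤ ⟨
  fromℤ (cubicForm E x 1ℤ)
    ≡⟨ cong fromℤ (trans (cubicForm-dehomogenise E x) root) ⟩
  0ℚ ∎
  where
  open ≡-Reasoning
  open ℚSolver.+-*-Solver
  X = fromℤ x

IsTwoTorsionX⇒cubicForm≡0 : ∀ E q → IsTwoTorsionX E q → cubicForm E (↥ q) (↧ q) ≡ 0ℤ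
IsTwoTorsionX⇒cubicForm≡0 E@(A , B) q root = fromℤ-injective (begin
  fromℤ (cubicForm E (↥ q) (↧ q))
    ≡⟨ fromℤ-cubicForm A B (↥ q) (↧ q) ⟩
  N ℚ.* N ℚ.* N ℚ.+ fromℤ A ℚ.* N ℚ.* (D ℚ.* D) ℚ.+ fromℤ B ℚ.* (D ℚ.* D ℚ.* D)
    ≡⟨ cong (λ N → N ℚ.* N ℚ.* N ℚ.+ fromℤ A ℚ.* N ℚ.* (D ℚ.* D) ℚ.+ fromℤ B ℚ.* (D ℚ.* D ℚ.* D))
            (sym (*-fromℤ-denominator q)) ⟩
  (q ℚ.* D) ℚ.* (q ℚ.* D) ℚ.* (q ℚ.* D) ℚ.+ fromℤ A ℚ.* (q ℚ.* D) ℚ.* (D ℚ.* D) ℚ.+ fromℤ B ℚ.* (D ℚ.* D ℚ.* D)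
    ≡⟨ solve 4 (λ q D A B → (q :* D) :* (q :* D) :* (q :* D) :+ A :* (q :* D) :* (D :* D) :+ B :* (D :* D :* D)
                 := (D :* D :* D) :* (q :* q :* q :+ A :* q :+ B)) refl q D (fromℤ A) (fromℤ B) ⟩
  (D ℚ.* D ℚ.* D) ℚ.* (q ℚ.* q ℚ.* q ℚ.+ fromℤ A ℚ.* q ℚ.+ fromℤ B)
    ≡⟨ cong ((D ℚ.* D ℚ.* D) ℚ.*_) root ⟩
  (D ℚ.* D ℚ.* D) ℚ.* 0ℚ
    ≡⟨ ℚP.*-zeroʳ (D ℚ.* D ℚ.* D) ⟩
  0ℚ ∎)
  where
  open ≡-Reasoning
  open ℚSolver.+-*-Solver
  N = fromℤ (↥ q)
  D = fromℤ (↧ q)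

abs-cube : ∀ n → ℤ.∣ n ℤ.* n ℤ.* n ∣ ≡ ℤ.∣ n ∣ ^ 3
abs-cube n = begin
  ℤ.∣ n ℤ.* n ℤ.* n ∣          ≡⟨ ℤP.abs-* (n ℤ.* n) n ⟩
  ℤ.∣ n ℤ.* n ∣ * ℤ.∣ n ∣      ≡⟨ cong (_* ℤ.∣ n ∣) (ℤP.abs-* n n) ⟩
  ℤ.∣ n ∣ * ℤ.∣ n ∣ * ℤ.∣ n ∣  ≡⟨ solve 1 (λ n → n :* n :* n := n :^ 3) refl ℤ.∣ n ∣ ⟩
  ℤ.∣ n ∣ ^ 3                  ∎
  where open ≡-Reasoning; open ℕSolver.+-*-Solver

cubicForm≡0⇒∣cube : ∀ E n d → cubicForm E n d ≡ 0ℤ → ℤ.∣ d ∣ ∣ ℤ.∣ n ∣ ^ 3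
cubicForm≡0⇒∣cube E@(A , B) n d form≡0 = begin
  ℤ.∣ d ∣                  ∣⟨ m∣m*n ℤ.∣ W ∣ ⟩
  ℤ.∣ d ∣ * ℤ.∣ W ∣        ≡⟨ ℤP.abs-* d W ⟨
  ℤ.∣ d ℤ.* W ∣            ≡⟨ ℤP.∣-i∣≡∣i∣ (d ℤ.* W) ⟨
  ℤ.∣ ℤ.- (d ℤ.* W) ∣      ≡⟨ cong ℤ.∣_∣ n³≡-dW ⟨
  ℤ.∣ n ℤ.* n ℤ.* n ∣      ≡⟨ abs-cube n ⟩
  ℤ.∣ n ∣ ^ 3              ∎
  where
  open ∣-Reasoning
  W = A ℤ.* n ℤ.* d ℤ.+ B ℤ.* (d ℤ.* d)
  n³≡-dW : n ℤ.* n ℤ.* n ≡ ℤ.- (d ℤ.* W)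
  n³≡-dW = trans (solve 4 (λ n A B d → n :* n :* n :=
                   (n :* n :* n :+ A :* n :* (d :* d) :+ B :* (d :* d :* d)) :- d :* (A :* n :* d :+ B :* (d :* d)))
                   refl n A B d)
                 (trans (cong (ℤ._- d ℤ.* W) form≡0) (ℤP.+-identityˡ _))
    where open ℤSolver.+-*-Solver

rational-root-theorem : ∀ E q → IsTwoTorsionX E q → ∃ λ x → q ≡ fromℤ x × cubic E x ≡ 0ℤ
rational-root-theorem E q@(mkℚ n d-1 n⊥d) root = n , q≡n , n-root
  where
  form≡0 : cubicForm E n (↧ q) ≡ 0ℤ
  form≡0 = IsTwoTorsionX⇒cubicForm≡0 E q root
  ↧q≡1 : ↧ q ≡ 1ℤ
  ↧q≡1 = cong +_ (coprime∧∣^⇒≡1 3 (Coprimality.sym (Coprimality.recompute n⊥d))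
                                  (cubicForm≡0⇒∣cube E n (↧ q) form≡0))
  q≡n : q ≡ fromℤ n
  q≡n = begin
    q                       ≡⟨ ℚP.*-identityʳ q ⟨
    q ℚ.* fromℤ 1ℤ          ≡⟨ cong (λ d → q ℚ.* fromℤ d) ↧q≡1 ⟨
    q ℚ.* fromℤ (↧ q)       ≡⟨ *-fromℤ-denominator q ⟩
    fromℤ n                 ∎
    where open ≡-Reasoning
  n-root : cubic E n ≡ 0ℤ
  n-root = trans (sym (cubicForm-dehomogenise E n)) (subst (λ d → cubicForm E n d ≡ 0ℤ) ↧q≡1 form≡0)

normForm : ℤ → ℤ → ℤ
normForm x y = x ℤ.* x ℤ.+ x ℤ.* y ℤ.+ y ℤ.* y

modelWithRoots : ℤ → ℤ → Model
modelWithRoots x y = ℤ.- normForm x y , x ℤ.* y ℤ.* (x ℤ.+ y)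

cubic-difference : ∀ A B x y → cubic (A , B) x ℤ.- cubic (A , B) y ≡ (x ℤ.- y) ℤ.* (A ℤ.- ℤ.- normForm x y)
cubic-difference = solve 4 (λ A B x y → (x :* x :* x :+ A :* x :+ B) :- (y :* y :* y :+ A :* y :+ B)
                              := (x :- y) :* (A :- :- (x :* x :+ x :* y :+ y :* y))) refl
  where open ℤSolver.+-*-Solver

two-roots⇒modelWithRoots : ∀ E {x y} → x ≢ y → cubic E x ≡ 0ℤ → cubic E y ≡ 0ℤ → E ≡ modelWithRoots x y
two-roots⇒modelWithRoots E@(A , B) {x} {y} x≢y x-root y-root =
  cong₂ _,_ (ℤP.i-j≡0⇒i≡j A (ℤ.- Q) A+Q≡0) (ℤP.i-j≡0⇒i≡j B (x ℤ.* y ℤ.* (x ℤ.+ y)) B-xy[x+y]≡0)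
  where
  open ≡-Reasoning
  Q = normForm x y
  [x-y][A+Q]≡0 : (x ℤ.- y) ℤ.* (A ℤ.- ℤ.- Q) ≡ 0ℤ
  [x-y][A+Q]≡0 = trans (sym (cubic-difference A B x y)) (cong₂ ℤ._-_ x-root y-root)
  A+Q≡0 : A ℤ.- ℤ.- Q ≡ 0ℤ
  A+Q≡0 = [ (λ x-y≡0 → contradiction (ℤP.i-j≡0⇒i≡j x y x-y≡0) x≢y) , id ]′
            (ℤP.i*j≡0⇒i≡0∨j≡0 (x ℤ.- y) [x-y][A+Q]≡0)
  B-xy[x+y]≡0 : B ℤ.- x ℤ.* y ℤ.* (x ℤ.+ y) ≡ 0ℤ
  B-xy[x+y]≡0 = begin
    B ℤ.- x ℤ.* y ℤ.* (x ℤ.+ y)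
      ≡⟨ solve 4 (λ x y A B → B :- x :* y :* (x :+ y)
           := (x :* x :* x :+ A :* x :+ B) :- x :* (A :- :- (x :* x :+ x :* y :+ y :* y))) refl x y A B ⟩
    cubic E x ℤ.- x ℤ.* (A ℤ.- ℤ.- Q)
      ≡⟨ cong₂ ℤ._-_ x-root (trans (cong (x ℤ.*_) A+Q≡0) (ℤP.*-zeroʳ x)) ⟩
    0ℤ ∎
    where open ℤSolver.+-*-Solver

fullTwoTorsion⇒modelWithRoots : ∀ E → FullTwoTorsion E → ∃ λ x → ∃ λ y → E ≡ modelWithRoots x y
fullTwoTorsion⇒modelWithRoots E (q₁ , q₂ , _ , q₁-root , q₂-root , _ , q₁≢q₂ , _)
  with rational-root-theorem E q₁ q₁-root | rational-root-theorem E q₂ q₂-root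
... | x , q₁≡x , x-root | y , q₂≡y , y-root =
  x , y , two-roots⇒modelWithRoots E {x} {y}
            (λ x≡y → q₁≢q₂ (trans q₁≡x (trans (cong fromℤ x≡y) (sym q₂≡y)))) x-root y-root

abs-square : ∀ i → + (ℤ.∣ i ∣ * ℤ.∣ i ∣) ≡ i ℤ.* i
abs-square (+ n)    = ℤP.pos-* n n
abs-square -[1+ n ] = refl

3x²≤4normForm : ∀ x y → 3 * (ℤ.∣ x ∣ * ℤ.∣ x ∣) ≤ 4 * ℤ.∣ normForm x y ∣
3x²≤4normForm x y =
  subst (3 * (ℤ.∣ x ∣ * ℤ.∣ x ∣) ≤_) 3x²+s²≡4Q (ℕP.m≤m+n (3 * (ℤ.∣ x ∣ * ℤ.∣ x ∣)) (ℤ.∣ s ∣ * ℤ.∣ s ∣))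
  where
  open ≡-Reasoning
  s = x ℤ.+ + 2 ℤ.* y
  3x²+s²≡4Q : 3 * (ℤ.∣ x ∣ * ℤ.∣ x ∣) + ℤ.∣ s ∣ * ℤ.∣ s ∣ ≡ 4 * ℤ.∣ normForm x y ∣
  3x²+s²≡4Q = begin
    ℤ.∣ + (3 * (ℤ.∣ x ∣ * ℤ.∣ x ∣) + ℤ.∣ s ∣ * ℤ.∣ s ∣) ∣
      ≡⟨ cong ℤ.∣_∣ (ℤP.pos-+ (3 * (ℤ.∣ x ∣ * ℤ.∣ x ∣)) (ℤ.∣ s ∣ * ℤ.∣ s ∣)) ⟩
    ℤ.∣ + (3 * (ℤ.∣ x ∣ * ℤ.∣ x ∣)) ℤ.+ + (ℤ.∣ s ∣ * ℤ.∣ s ∣) ∣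
      ≡⟨ cong (λ t → ℤ.∣ t ℤ.+ + (ℤ.∣ s ∣ * ℤ.∣ s ∣) ∣) (ℤP.pos-* 3 (ℤ.∣ x ∣ * ℤ.∣ x ∣)) ⟩
    ℤ.∣ + 3 ℤ.* + (ℤ.∣ x ∣ * ℤ.∣ x ∣) ℤ.+ + (ℤ.∣ s ∣ * ℤ.∣ s ∣) ∣
      ≡⟨ cong₂ (λ u v → ℤ.∣ + 3 ℤ.* u ℤ.+ v ∣) (abs-square x) (abs-square s) ⟩
    ℤ.∣ + 3 ℤ.* (x ℤ.* x) ℤ.+ s ℤ.* s ∣
      ≡⟨ cong ℤ.∣_∣ (solve 2 (λ x y → con (+ 3) :* (x :* x) :+ (x :+ con (+ 2) :* y) :* (x :+ con (+ 2) :* y)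
                              := con (+ 4) :* (x :* x :+ x :* y :+ y :* y)) refl x y) ⟩
    ℤ.∣ + 4 ℤ.* normForm x y ∣
      ≡⟨ ℤP.abs-* (+ 4) (normForm x y) ⟩
    4 * ℤ.∣ normForm x y ∣ ∎
    where open ℤSolver.+-*-Solver

normForm-sym : ∀ x y → normForm x y ≡ normForm y x
normForm-sym = solve 2 (λ x y → x :* x :+ x :* y :+ y :* y := y :* y :+ y :* x :+ x :* x) refl
  where open ℤSolver.+-*-Solver

3u≤e⇒64u⁶≤q³ : ∀ {u e q} → 3 * u ≤ e → 3 * (e * e) ≤ 4 * q → 64 * u ^ 6 ≤ q ^ 3
3u≤e⇒64u⁶≤q³ {u} {e} {q} 3u≤e 3e²≤4q = begin
  64 * u ^ 6         ≡⟨ solve 1 (λ u → con 64 :* u :^ 6 := (con 4 :* (u :* u)) :^ 3) refl u ⟩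
  (4 * (u * u)) ^ 3  ≤⟨ ℕP.^-monoˡ-≤ 3 (ℕP.*-cancelˡ-≤ {4 * (u * u)} {q} 4 16u²≤4q) ⟩
  q ^ 3              ∎
  where
  open ℕP.≤-Reasoning
  open ℕSolver.+-*-Solver
  16u²≤4q : 4 * (4 * (u * u)) ≤ 4 * q
  16u²≤4q = begin
    4 * (4 * (u * u))      ≡⟨ solve 1 (λ u → con 4 :* (con 4 :* (u :* u)) := con 16 :* (u :* u)) refl u ⟩
    16 * (u * u)           ≤⟨ ℕP.*-monoˡ-≤ (u * u) {16} {27} (ℕP.m≤m+n 16 11) ⟩
    27 * (u * u)           ≡⟨ solve 1 (λ u → con 27 :* (u :* u) := con 3 :* (con 3 :* u :* (con 3 :* u))) refl u ⟩
    3 * (3 * u * (3 * u))  ≤⟨ ℕP.*-monoʳ-≤ 3 (ℕP.*-mono-≤ 3u≤e 3u≤e) ⟩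
    3 * (e * e)            ≤⟨ 3e²≤4q ⟩
    4 * q                  ∎

normForm-bound : ∀ m T x y → ℤ.∣ normForm x y ∣ ^ 3 ≤ T → T < 64 * suc m ^ 6 → ℤ.∣ x ∣ ≤ 3 * m + 2
normForm-bound m T x y Q³≤T T<64[m+1]⁶ with ℤ.∣ x ∣ ≤? 3 * m + 2
... | yes x≤3m+2 = x≤3m+2
... | no  x≰3m+2 = contradiction (ℕP.≤-trans 64[m+1]⁶≤Q³ Q³≤T) (ℕP.<⇒≱ T<64[m+1]⁶)
  where
  3[m+1]≤x : 3 * suc m ≤ ℤ.∣ x ∣
  3[m+1]≤x = subst (_≤ ℤ.∣ x ∣) (solve 1 (λ m → con 1 :+ (con 3 :* m :+ con 2) := con 3 :* (con 1 :+ m)) refl m)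
                   (ℕP.≰⇒> x≰3m+2)
    where open ℕSolver.+-*-Solver
  64[m+1]⁶≤Q³ : 64 * suc m ^ 6 ≤ ℤ.∣ normForm x y ∣ ^ 3
  64[m+1]⁶≤Q³ = 3u≤e⇒64u⁶≤q³ {suc m} {ℤ.∣ x ∣} {ℤ.∣ normForm x y ∣} 3[m+1]≤x (3x²≤4normForm x y)

modelsWithRootsUpTo : ℕ → List Model
modelsWithRootsUpTo c = cartesianProductWith modelWithRoots (integersUpTo c) (integersUpTo c)

length-modelsWithRootsUpTo : ∀ c → length (modelsWithRootsUpTo c) ≡ (suc c + c) * (suc c + c)
length-modelsWithRootsUpTo c = trans (length-cartesianProductWith modelWithRoots (integersUpTo c) (integersUpTo c))
                                     (cong₂ _*_ (length-integersUpTo c) (length-integersUpTo c))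

modelWithRoots∈modelsWithRootsUpTo : ∀ {m T} x y → HeightPow6≤ T (modelWithRoots x y) → T < 64 * suc m ^ 6 →
  modelWithRoots x y ∈ modelsWithRootsUpTo (3 * m + 2)
modelWithRoots∈modelsWithRootsUpTo {m} {T} x y (A³≤T , _) T<64[m+1]⁶ = ∈-cartesianProductWith⁺ modelWithRoots
  (∈-integersUpTo x (normForm-bound m T x y Q[x,y]³≤T T<64[m+1]⁶))
  (∈-integersUpTo y (normForm-bound m T y x (subst (λ Q → ℤ.∣ Q ∣ ^ 3 ≤ T) (normForm-sym x y) Q[x,y]³≤T) T<64[m+1]⁶))
  where
  Q[x,y]³≤T : ℤ.∣ normForm x y ∣ ^ 3 ≤ T
  Q[x,y]³≤T = subst (λ n → n ^ 3 ≤ T) (ℤP.∣-i∣≡∣i∣ (normForm x y)) A³≤T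

fullTwoTorsion⇒∈modelsWithRootsUpTo : ∀ {m T} E → FullTwoTorsion E → HeightPow6≤ T E → T < 64 * suc m ^ 6 →
  E ∈ modelsWithRootsUpTo (3 * m + 2)
fullTwoTorsion⇒∈modelsWithRootsUpTo {m} {T} E full height T<64[m+1]⁶ =
  subst (_∈ modelsWithRootsUpTo (3 * m + 2)) (sym E≡)
        (modelWithRoots∈modelsWithRootsUpTo {m} x y (subst (HeightPow6≤ T) E≡ height) T<64[m+1]⁶)
  where
  x = proj₁ (fullTwoTorsion⇒modelWithRoots E full)
  y = proj₁ (proj₂ (fullTwoTorsion⇒modelWithRoots E full))
  E≡ : E ≡ modelWithRoots x y
  E≡ = proj₂ (proj₂ (fullTwoTorsion⇒modelWithRoots E full))

nonsingular-A>0 : ∀ c B → Nonsingular (+[1+ c ] , B)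
nonsingular-A>0 c (+ 0)     ()
nonsingular-A>0 c +[1+ n ]  ()
nonsingular-A>0 c -[1+ n ]  ()

HeightPow6≤-mono : ∀ {T T′} E → T ≤ T′ → HeightPow6≤ T E → HeightPow6≤ T′ E
HeightPow6≤-mono _ T≤T′ (A³≤T , B²≤T) = ℕP.≤-trans A³≤T T≤T′ , ℕP.≤-trans B²≤T T≤T′

withRoot : ℕ → ℕ → Model
withRoot r A = + A , ℤ.- + (r * r * r + A * r)

withRoot-root : ∀ r A → cubic (withRoot r A) (+ r) ≡ 0ℤ
withRoot-root r A = begin
  R ℤ.* R ℤ.* R ℤ.+ + A ℤ.* R ℤ.+ ℤ.- + (r * r * r + A * r)
    ≡⟨ cong (λ b → R ℤ.* R ℤ.* R ℤ.+ + A ℤ.* R ℤ.+ ℤ.- b) +[r³+Ar]≡R³+AR ⟩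
  R ℤ.* R ℤ.* R ℤ.+ + A ℤ.* R ℤ.+ ℤ.- (R ℤ.* R ℤ.* R ℤ.+ + A ℤ.* R)
    ≡⟨ ℤP.+-inverseʳ (R ℤ.* R ℤ.* R ℤ.+ + A ℤ.* R) ⟩
  0ℤ ∎
  where
  open ≡-Reasoning
  R = + r
  +[r³+Ar]≡R³+AR : + (r * r * r + A * r) ≡ R ℤ.* R ℤ.* R ℤ.+ + A ℤ.* R
  +[r³+Ar]≡R³+AR = trans (ℤP.pos-+ (r * r * r) (A * r))
    (cong₂ ℤ._+_ (trans (ℤP.pos-* (r * r) r) (cong (ℤ._* R) (ℤP.pos-* r r))) (ℤP.pos-* A r))

withRoot-injective : ∀ {r s A C} → withRoot r A ≡ withRoot s C → r ≡ s × A ≡ C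
withRoot-injective {r} {s} {A} {C} eq with ℤP.+-injective (cong proj₁ eq)
... | refl = Cubic.injective (ℤP.+-injective (ℤP.neg-injective (cong proj₂ eq))) , refl
  where
  module Cubic = StrictlyIncreasing {λ r → r * r * r + A * r}
    (λ r<s → ℕP.+-mono-<-≤ (ℕP.*-mono-< (ℕP.*-mono-< r<s r<s) r<s) (ℕP.*-monoʳ-≤ A (ℕP.<⇒≤ r<s)))

withRoot-minimal : ∀ r A → (∀ {p} → Prime p → p ∣ A → p ∣ r → ⊥) → Minimal (withRoot r A)
withRoot-minimal r A no-common-prime p p-prime (p⁴∣A , p⁶∣B) = no-common-prime p-prime p∣A p∣r
  where
  p∣A : p ∣ A
  p∣A = ∣-trans (m∣m*n (p ^ 3)) p⁴∣A
  p∣r³+Ar : p ∣ r * r * r + A * r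
  p∣r³+Ar = subst (p ∣_) (ℤP.∣-i∣≡∣i∣ (+ (r * r * r + A * r))) (∣-trans (m∣m*n (p ^ 5)) p⁶∣B)
  r³+Ar≡Ar+r^3 : r * r * r + A * r ≡ A * r + r ^ 3
  r³+Ar≡Ar+r^3 = solve 2 (λ r A → r :* r :* r :+ A :* r := A :* r :+ r :^ 3) refl r A
    where open ℕSolver.+-*-Solver
  p∣r : p ∣ r
  p∣r = prime∣^⇒∣ 3 p-prime (∣m+n∣m⇒∣n (subst (p ∣_) r³+Ar≡Ar+r^3 p∣r³+Ar) (∣m⇒∣m*n r p∣A))

withRoot-height : ∀ {m r A} → r ≤ m → A ≤ 4 * (m * m) → HeightPow6≤ (64 * m ^ 6) (withRoot r A)
withRoot-height {m} {r} {A} r≤m A≤4m² = A³≤64m⁶ , B²≤64m⁶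
  where
  open ℕP.≤-Reasoning
  open ℕSolver.+-*-Solver
  A³≤64m⁶ : A ^ 3 ≤ 64 * m ^ 6
  A³≤64m⁶ = begin
    A ^ 3              ≤⟨ ℕP.^-monoˡ-≤ 3 A≤4m² ⟩
    (4 * (m * m)) ^ 3  ≡⟨ solve 1 (λ m → (con 4 :* (m :* m)) :^ 3 := con 64 :* m :^ 6) refl m ⟩
    64 * m ^ 6         ∎
  B²≤64m⁶ : ℤ.∣ ℤ.- + (r * r * r + A * r) ∣ ^ 2 ≤ 64 * m ^ 6
  B²≤64m⁶ = begin
    ℤ.∣ ℤ.- + (r * r * r + A * r) ∣ ^ 2
      ≡⟨ cong (_^ 2) (ℤP.∣-i∣≡∣i∣ (+ (r * r * r + A * r))) ⟩
    (r * r * r + A * r) ^ 2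
      ≤⟨ ℕP.^-monoˡ-≤ 2 (ℕP.+-mono-≤ (ℕP.*-mono-≤ (ℕP.*-mono-≤ r≤m r≤m) r≤m) (ℕP.*-mono-≤ A≤4m² r≤m)) ⟩
    (m * m * m + 4 * (m * m) * m) ^ 2
      ≡⟨ solve 1 (λ m → (m :* m :* m :+ con 4 :* (m :* m) :* m) :^ 2 := con 25 :* m :^ 6) refl m ⟩
    25 * m ^ 6
      ≤⟨ ℕP.*-monoˡ-≤ (m ^ 6) {25} {64} (ℕP.m≤m+n 25 39) ⟩
    64 * m ^ 6 ∎

familyCurve : ℕ → ℕ → Model
familyCurve j a = withRoot (2 ^ j) (suc (2 * a))

familyCurve-injective : ∀ {i j a b} → familyCurve i a ≡ familyCurve j b → i ≡ j × a ≡ b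
familyCurve-injective {a = a} {b} eq with withRoot-injective eq
... | 2ⁱ≡2ʲ , 2a+1≡2b+1 = PowersOfTwo.injective 2ⁱ≡2ʲ , ℕP.*-cancelˡ-≡ a b 2 (ℕP.suc-injective 2a+1≡2b+1)
  where module PowersOfTwo = StrictlyIncreasing (ℕP.^-monoʳ-< 2 (s≤s (s≤s z≤n)))

familyCurve-InE₂ : ∀ j a → InE₂ (familyCurve j a)
familyCurve-InE₂ j a =
  withRoot-minimal (2 ^ j) (suc (2 * a)) odd⊥2ʲ ,
  nonsingular-A>0 (2 * a) (proj₂ (familyCurve j a)) ,
  fromℤ (+ 2 ^ j) , cubic≡0⇒IsTwoTorsionX (familyCurve j a) (+ 2 ^ j) (withRoot-root (2 ^ j) (suc (2 * a)))
  where
  odd⊥2ʲ : ∀ {p} → Prime p → p ∣ suc (2 * a) → p ∣ 2 ^ j → ⊥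
  odd⊥2ʲ {p} p-prime p∣2a+1 p∣2ʲ = nonTrivial⇒≢1 {{prime⇒nonTrivial p-prime}} (∣1⇒≡1
    (∣m+n∣m⇒∣n (subst (p ∣_) (ℕP.+-comm 1 (2 * a)) p∣2a+1) (∣m⇒∣m*n a (prime∣^⇒∣ j p-prime p∣2ʲ))))

familyCurves : ℕ → ℕ → List Model
familyCurves R N = cartesianProductWith familyCurve (upTo R) (upTo N)

familyCurves-unique : ∀ R N → Unique (familyCurves R N)
familyCurves-unique R N = cartesianProductWith⁺ familyCurve familyCurve-injective (upTo⁺ R) (upTo⁺ N)

length-familyCurves : ∀ R N → length (familyCurves R N) ≡ R * N
length-familyCurves R N = trans (length-cartesianProductWith familyCurve (upTo R) (upTo N))
                                (cong₂ _*_ (ListP.length-upTo R) (ListP.length-upTo N))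

2a+1≤4n : ∀ {a n} → a < 2 * n → suc (2 * a) ≤ 4 * n
2a+1≤4n {a} {n} a<2n = begin
  suc (2 * a)  ≤⟨ ℕP.n≤1+n (suc (2 * a)) ⟩
  2 + 2 * a    ≡⟨ ℕP.*-suc 2 a ⟨
  2 * suc a    ≤⟨ ℕP.*-monoʳ-≤ 2 a<2n ⟩
  2 * (2 * n)  ≡⟨ ℕP.*-assoc 2 2 n ⟨
  4 * n        ∎
  where open ℕP.≤-Reasoning

familyCurves-valid : ∀ {R m T} → 2 ^ R ≤ m → 64 * m ^ 6 ≤ T →
  All (λ E → InE₂ E × HeightPow6≤ T E) (familyCurves R (2 * (m * m)))
familyCurves-valid {R} {m} {T} 2ᴿ≤m 64m⁶≤T = All.tabulate valid
  where
  valid : ∀ {E} → E ∈ familyCurves R (2 * (m * m)) → InE₂ E × HeightPow6≤ T E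
  valid E∈ with ∈-cartesianProductWith⁻ familyCurve (upTo R) (upTo (2 * (m * m))) E∈
  ... | j , a , j∈ , a∈ , refl = familyCurve-InE₂ j a ,
    HeightPow6≤-mono (familyCurve j a) 64m⁶≤T (withRoot-height {m} 2ʲ≤m (2a+1≤4n {a} {m * m} (∈-upTo⁻ a∈)))
    where
    2ʲ≤m : 2 ^ j ≤ m
    2ʲ≤m = ℕP.≤-trans (ℕP.^-monoʳ-≤ 2 (ℕP.<⇒≤ (∈-upTo⁻ j∈))) 2ᴿ≤m

count-comparison : ∀ k m → 1 ≤ m → let c = 3 * m + 2 in
  suc k * ((suc c + c) * (suc c + c)) ≤ (61 * k + 61) * (2 * (m * m))
count-comparison k m 1≤m = begin
  suc k * (X * X)                                ≤⟨ ℕP.*-monoʳ-≤ (suc k) (ℕP.*-mono-≤ X≤11m X≤11m) ⟩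
  suc k * (11 * m * (11 * m))                    ≤⟨ ℕP.m≤m+n _ (suc k * (m * m)) ⟩
  suc k * (11 * m * (11 * m)) + suc k * (m * m)  ≡⟨ solve 2 (λ k m →
    (con 1 :+ k) :* (con 11 :* m :* (con 11 :* m)) :+ (con 1 :+ k) :* (m :* m)
      := (con 61 :* k :+ con 61) :* (con 2 :* (m :* m))) refl k m ⟩
  (61 * k + 61) * (2 * (m * m))                  ∎
  where
  open ℕP.≤-Reasoning
  open ℕSolver.+-*-Solver
  c = 3 * m + 2
  X = suc c + c
  X≤11m : X ≤ 11 * m
  X≤11m = begin
    X              ≡⟨ solve 1 (λ m → con 1 :+ (con 3 :* m :+ con 2) :+ (con 3 :* m :+ con 2)
                                        := con 6 :* m :+ con 5 :* con 1) refl m ⟩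
    6 * m + 5 * 1  ≤⟨ ℕP.+-monoʳ-≤ (6 * m) (ℕP.*-monoʳ-≤ 5 1≤m) ⟩
    6 * m + 5 * m  ≡⟨ solve 1 (λ m → con 6 :* m :+ con 5 :* m := con 11 :* m) refl m ⟩
    11 * m         ∎

fullTwoTorsion-count : ∀ k {m T} {L : List Model} → 1 ≤ m → T < 64 * suc m ^ 6 → Unique L →
  All (λ E → InE₂ E × FullTwoTorsion E × HeightPow6≤ T E) L →
  suc k * length L ≤ (61 * k + 61) * (2 * (m * m))
fullTwoTorsion-count k {m} {L = L} 1≤m T<64[m+1]⁶ L-unique L-valid = begin
  suc k * length L                        ≤⟨ ℕP.*-monoʳ-≤ (suc k) (Unique∧⊆⇒length≤ L-unique L⊆) ⟩
  suc k * length (modelsWithRootsUpTo c)  ≡⟨ cong (suc k *_) (length-modelsWithRootsUpTo c) ⟩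
  suc k * ((suc c + c) * (suc c + c))     ≤⟨ count-comparison k m 1≤m ⟩
  (61 * k + 61) * (2 * (m * m))           ∎
  where
  open ℕP.≤-Reasoning
  c = 3 * m + 2
  L⊆ : L ⊆ modelsWithRootsUpTo c
  L⊆ {E} E∈L with All.lookup L-valid E∈L
  ... | _ , full , height = fullTwoTorsion⇒∈modelsWithRootsUpTo {m} E full height T<64[m+1]⁶

module SixthPower = StrictlyIncreasing {λ m → 64 * m ^ 6} (λ m<n → ℕP.*-monoʳ-< 64 (ℕP.^-monoˡ-< 6 m<n))

lemma4p4 : (k : ℕ) → ∃ λ T₀ → (T : ℕ) → T₀ ≤ T →
    (L : List Model) → Unique L →
    All (λ E → InE₂ E × FullTwoTorsion E × HeightPow6≤ T E) L →
    ∃ λ (M : List Model) → Unique M ×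
      All (λ E → InE₂ E × HeightPow6≤ T E) M ×
      suc k * length L ≤ length M
lemma4p4 k = 64 * (2 ^ R) ^ 6 , λ T T₀≤T L L-unique L-valid →
  let m , 64m⁶≤T , T<64[m+1]⁶ = SixthPower.floor refl T
      2ᴿ≤m = SixthPower.floor-maximal T₀≤T T<64[m+1]⁶
      N = 2 * (m * m)
  in familyCurves R N , familyCurves-unique R N , familyCurves-valid {R} 2ᴿ≤m 64m⁶≤T ,
     subst (suc k * length L ≤_) (sym (length-familyCurves R N))
           (fullTwoTorsion-count k {m} (ℕP.≤-trans (ℕP.m^n>0 2 R) 2ᴿ≤m) T<64[m+1]⁶ L-unique L-valid)
  where
  -- 61 (k + 1) written so that 2 ^ R does not unfold during type checking
  R = 61 * k + 61
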